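{- Consider fixed order scheduling with deadlines in which all processing times equal $1$ (problem $P|r_j=r,p_j=1,d_j,\pi^*|m$). Then the first-fit algorithm produces a feasible schedule using the minimum possible number of machines, and it runs in time $O(n^2)$.
   Context: Fixed order scheduling with deadlines: there are $n$ jobs $1,\dots,n$, job $j$ having processing time $p_j\in\mathbb{N}$, $p_j>0$, and deadline $d_j\in\mathbb{N}$ with $d_j\ge p_j$. All jobs are released at a common time, and there are sufficiently many identical machines. A schedule assigns jobs to machines; each machine processes its assigned jobs non-preemptively, without idle time, in increasing order of job index (the fixed order). The schedule is feasible if, for every job $j$, the total processing time of the jobs $k\le j$ assigned to the same machine as $j$ is at most $d_j$. The objective is to minimize the number of machines that receive at least one job. The first-fit algorithm (FF) considers jobs in the order $1,\dots,n$ and appends each job to the lowest-indexed open machine on which it would meet its deadline, opening a new machine if there is none. -}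

module Defs where

open import Data.Nat using (ℕ; zero; suc; _+_; _*_; _≤_; _≤?_)
open import Data.Nat.Properties using (_≟_)
open import Data.Fin using (Fin; toℕ)
open import Data.Nat.ListAction using (sum)
open import Data.List using (List; []; _∷_; map; filter; length; allFin; deduplicate)
open import Data.Product using (_×_; _,_; proj₁; proj₂)
open import Relation.Nullary.Decidable using (yes; no; _×-dec_)

-- An instance with n jobs: processing times p and deadlines d, indexed by Fin n.
-- Job order = order of Fin n indices. A schedule assigns each job a machine label
-- σ j : ℕ.

loadUpTo : (n : ℕ) → (p : Fin n → ℕ) → (σ : Fin n → ℕ) → Fin n → ℕ
loadUpTo n p σ j =
  sum (map p (filter (λ k → (toℕ k ≤? toℕ j) ×-dec (σ k ≟ σ j)) (allFin n)))

Feasible : (n : ℕ) → (p d : Fin n → ℕ) → (Fin n → ℕ) → Set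
Feasible n p d σ = ∀ (j : Fin n) → loadUpTo n p σ j ≤ d j

machinesUsed : (n : ℕ) → (Fin n → ℕ) → ℕ
machinesUsed n σ = length (deduplicate _≟_ (map σ (allFin n)))

-- Open machines are kept as the list of their current loads,
-- indexed by opening order (lowest index first). Placing a job of processing
-- time q and deadline e returns (machine index, new loads, number of machines
-- examined, counting the opening of a new machine as one step).
place : ℕ → ℕ → List ℕ → ℕ × List ℕ × ℕ
place q e [] = 0 , (q ∷ []) , 1
place q e (l ∷ ls) with (l + q) ≤? e
... | yes _ = 0 , ((l + q) ∷ ls) , 1
... | no _ with place q e ls
...   | i , ls' , s = suc i , (l ∷ ls') , suc s

ffGo : List (ℕ × ℕ) → List ℕ → List ℕ × ℕ
ffGo [] loads = [] , 0
ffGo ((q , e) ∷ js) loads with place q e loads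
... | i , loads' , s with ffGo js loads'
...   | as , s' = (i ∷ as) , (s + s')

ffRun : (n : ℕ) → (p d : Fin n → ℕ) → List ℕ × ℕ
ffRun n p d = ffGo (map (λ j → p j , d j) (allFin n)) []

nth : List ℕ → ℕ → ℕ
nth [] _ = 0
nth (x ∷ xs) zero = x
nth (x ∷ xs) (suc k) = nth xs k

ffSchedule : (n : ℕ) → (p d : Fin n → ℕ) → Fin n → ℕ
ffSchedule n p d j = nth (proj₁ (ffRun n p d)) (toℕ j)

ffSteps : (n : ℕ) → (p d : Fin n → ℕ) → ℕ
ffSteps n p d = proj₂ (ffRun n p d)

{-# OPTIONS --safe #-}
module Submission where

-- A schedule of unit jobs is described by its load vector f : ℕ → ℕ (machine ↦ number of jobs).
-- Compare load vectors through Φ_f(t) = Σ_y min(f y, t) (massBelow), whose value at t = 1 is the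
-- number of used machines: A is dominated by B if Φ_A ≤ Φ_B at every level t.  Run first fit and
-- an arbitrary feasible schedule side by side, job by job.  First fit keeps its loads nonincreasing
-- along the machine order and puts a job with deadline e on the first machine whose load a is below
-- e, so no first-fit load lies strictly between a and e.  This gap keeps first fit dominated when the
-- other schedule adds the job to a machine of load b < e: at the levels a < t ≤ b only the other
-- side grows, and there Φ_A(t) < Φ_B(t) already holds.  Each placement examines at most one
-- machine more than there are jobs placed before, which gives n² steps.

open import Defs
open import Data.Nat
  using (ℕ; zero; suc; _+_; _*_; _⊓_; _≤_; _<_; _≰_; _≤′_; z≤n; s≤s; s≤s⁻¹; ≤′-refl; ≤′-step;
         _≤?_; _<?_)
open import Data.Nat.Properties
open import Data.Nat.ListAction using (sum)
open import Data.Fin using (Fin; toℕ) renaming (zero to fzero; suc to fsuc)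
open import Data.List using (List; []; _∷_; map; length; filter; tabulate; allFin; deduplicate)
open import Data.List.Properties
  using (filter-accept; filter-reject; filter-none; filter-≐; map-tabulate; map-∘; tabulate-cong;
         length-tabulate)
open import Data.List.Relation.Unary.All as All using (All; []; _∷_)
open import Data.List.Relation.Unary.All.Properties using (tabulate⁺; deduplicate⁺)
open import Data.List.Extrema.Nat using (max; xs≤max)
open import Data.Product using (_×_; _,_; proj₁; proj₂; ∃)
open import Data.Sum using (_⊎_; inj₁; inj₂)
open import Data.Bool using (true; false)
open import Function using (_∘_; id)
open import Relation.Nullary using (Dec; yes; no; does; ¬?; contradiction; _×-dec_)
open import Relation.Unary using (Decidable)
open import Relation.Binary.PropositionalEquality
open import Algebra.Properties.Semiring.Sum +-*-semiring
  using (∑-distrib-+; *-distribˡ-sum; sum-cong-≗; sum-replicate-zero)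
  renaming (sum to ∑)

δ : ℕ → ℕ → ℕ
δ zero    zero    = 1
δ zero    (suc _) = 0
δ (suc _) zero    = 0
δ (suc x) (suc y) = δ x y

δ-≡ : ∀ {x y} → x ≡ y → δ x y ≡ 1
δ-≡ {zero}  refl = refl
δ-≡ {suc x} refl = δ-≡ {x} refl

δ-≢ : ∀ {x y} → x ≢ y → δ x y ≡ 0
δ-≢ {zero}  {zero}  x≢y = contradiction refl x≢y
δ-≢ {zero}  {suc _} _   = refl
δ-≢ {suc _} {zero}  _   = refl
δ-≢ {suc x} {suc y} x≢y = δ-≢ (x≢y ∘ cong suc)

𝟙 : {P : Set} → Dec P → ℕ
𝟙 (yes _) = 1
𝟙 (no _)  = 0

bump : ℕ → (ℕ → ℕ) → ℕ → ℕ
bump x f y = f y + δ x y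

loads : List ℕ → ℕ → ℕ
loads []       y = 0
loads (x ∷ xs) y = δ x y + loads xs y

sumBelow : ℕ → (ℕ → ℕ) → ℕ
sumBelow N f = ∑ {N} (f ∘ toℕ)

sumBelow-mono-≤ : ∀ N {f g : ℕ → ℕ} → (∀ y → f y ≤ g y) →
                  sumBelow N f ≤ sumBelow N g
sumBelow-mono-≤ zero    f≤g = z≤n
sumBelow-mono-≤ (suc N) f≤g = +-mono-≤ (f≤g 0) (sumBelow-mono-≤ N (f≤g ∘ suc))

sumBelow-mono-< : ∀ {N x} {f g : ℕ → ℕ} → (∀ y → f y ≤ g y) → x < N → f x < g x →
                  sumBelow N f < sumBelow N g
sumBelow-mono-< {suc N} {zero}  f≤g _         fx<gx =
  +-mono-<-≤ fx<gx (sumBelow-mono-≤ N (f≤g ∘ suc))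
sumBelow-mono-< {suc N} {suc x} f≤g (s≤s x<N) fx<gx =
  +-mono-≤-< (f≤g 0) (sumBelow-mono-< (f≤g ∘ suc) x<N fx<gx)

sumBelow-δ* : ∀ {N x} (g : ℕ → ℕ) → x < N → sumBelow N (λ y → δ x y * g y) ≡ g x
sumBelow-δ* {suc N} {zero}  g _         =
  trans (cong₂ _+_ (+-identityʳ (g 0)) (sum-replicate-zero N)) (+-identityʳ (g 0))
sumBelow-δ* {suc N} {suc x} g (s≤s x<N) = sumBelow-δ* (g ∘ suc) x<N

sumBelow-δ : ∀ {N x} → x < N → sumBelow N (δ x) ≡ 1
sumBelow-δ {N} {x} x<N =
  trans (sum-cong-≗ {N} (λ y → sym (*-identityʳ (δ x (toℕ y))))) (sumBelow-δ* (λ _ → 1) x<N)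

-- Dominance of load vectors

⊓-+1 : ∀ v t → (v + 1) ⊓ t ≡ 𝟙 (v <? t) + v ⊓ t
⊓-+1 v t with v <? t
... | yes v<t = begin
  (v + 1) ⊓ t ≡⟨ m≤n⇒m⊓n≡m (subst (_≤ t) (+-comm 1 v) v<t) ⟩
  v + 1       ≡⟨ +-comm v 1 ⟩
  1 + v       ≡⟨ cong (1 +_) (sym (m≤n⇒m⊓n≡m (<⇒≤ v<t))) ⟩
  1 + v ⊓ t   ∎
  where open ≡-Reasoning
... | no v≮t = trans (m≥n⇒m⊓n≡n (≤-trans t≤v (m≤m+n v 1))) (sym (m≥n⇒m⊓n≡n t≤v))
  where t≤v = ≮⇒≥ v≮t

⊓-suc : ∀ v s → v ⊓ suc s ≡ v ⊓ s + 𝟙 (suc s ≤? v)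
⊓-suc v s with suc s ≤? v
... | yes s<v = begin
  v ⊓ suc s ≡⟨ m≥n⇒m⊓n≡n s<v ⟩
  suc s     ≡⟨ +-comm 1 s ⟩
  s + 1     ≡⟨ cong (_+ 1) (sym (m≥n⇒m⊓n≡n (<⇒≤ s<v))) ⟩
  v ⊓ s + 1 ∎
  where open ≡-Reasoning
... | no s≮v = begin
  v ⊓ suc s ≡⟨ m≤n⇒m⊓n≡m (m≤n⇒m≤1+n v≤s) ⟩
  v         ≡⟨ sym (m≤n⇒m⊓n≡m v≤s) ⟩
  v ⊓ s     ≡⟨ sym (+-identityʳ (v ⊓ s)) ⟩
  v ⊓ s + 0 ∎
  where open ≡-Reasoning
        v≤s = ≮⇒≥ s≮v

⊓-+-below : ∀ {v t} k → v < t → v ⊓ (t + k) ≡ v ⊓ t + k * 0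
⊓-+-below {v} {t} k v<t = begin
  v ⊓ (t + k)   ≡⟨ m≤n⇒m⊓n≡m (≤-trans (<⇒≤ v<t) (m≤m+n t k)) ⟩
  v             ≡⟨ sym (m≤n⇒m⊓n≡m (<⇒≤ v<t)) ⟩
  v ⊓ t         ≡⟨ sym (+-identityʳ (v ⊓ t)) ⟩
  v ⊓ t + 0     ≡⟨ cong (v ⊓ t +_) (sym (*-zeroʳ k)) ⟩
  v ⊓ t + k * 0 ∎
  where open ≡-Reasoning

t≤v⇒t+k≡v⊓t+k*1 : ∀ {v t} k → t ≤ v → t + k ≡ v ⊓ t + k * 1
t≤v⇒t+k≡v⊓t+k*1 k t≤v = cong₂ _+_ (sym (m≥n⇒m⊓n≡n t≤v)) (sym (*-identityʳ k))

⊓-+-outside : ∀ {v t k} → v < t ⊎ t + k ≤ v → v ⊓ (t + k) ≡ v ⊓ t + k * 𝟙 (t ≤? v)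
⊓-+-outside {v} {t} {k} v∉ with t ≤? v | v∉
... | no _    | inj₁ v<t   = ⊓-+-below k v<t
... | no t≰v  | inj₂ t+k≤v = contradiction (≤-trans (m≤m+n t k) t+k≤v) t≰v
... | yes t≤v | inj₁ v<t   = contradiction t≤v (<⇒≱ v<t)
... | yes t≤v | inj₂ t+k≤v = begin
  v ⊓ (t + k)   ≡⟨ m≥n⇒m⊓n≡n t+k≤v ⟩
  t + k         ≡⟨ t≤v⇒t+k≡v⊓t+k*1 k t≤v ⟩
  v ⊓ t + k * 1 ∎
  where open ≡-Reasoning

⊓-+-≤ : ∀ v t k → v ⊓ (t + k) ≤ v ⊓ t + k * 𝟙 (t ≤? v)
⊓-+-≤ v t k with t ≤? v
... | no t≰v  = ≤-reflexive (⊓-+-below k (≰⇒> t≰v))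
... | yes t≤v = begin
  v ⊓ (t + k)   ≤⟨ m⊓n≤n v (t + k) ⟩
  t + k         ≡⟨ t≤v⇒t+k≡v⊓t+k*1 k t≤v ⟩
  v ⊓ t + k * 1 ∎
  where open ≤-Reasoning

⊓-+-inside : ∀ {v t k} → t ≤ v → v < t + k → v ⊓ (t + k) < v ⊓ t + k * 𝟙 (t ≤? v)
⊓-+-inside {v} {t} {k} t≤v v<t+k with t ≤? v
... | no t≰v = contradiction t≤v t≰v
... | yes _  = begin-strict
  v ⊓ (t + k)   ≡⟨ m≤n⇒m⊓n≡m (<⇒≤ v<t+k) ⟩
  v             <⟨ v<t+k ⟩
  t + k         ≡⟨ t≤v⇒t+k≡v⊓t+k*1 k t≤v ⟩
  v ⊓ t + k * 1 ∎
  where open ≤-Reasoning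

massBelow : ℕ → (ℕ → ℕ) → ℕ → ℕ
massBelow N f t = sumBelow N (λ y → f y ⊓ t)

countAtLeast : ℕ → (ℕ → ℕ) → ℕ → ℕ
countAtLeast N f t = sumBelow N (λ y → 𝟙 (t ≤? f y))

Dominated : ℕ → (ℕ → ℕ) → (ℕ → ℕ) → Set
Dominated N A B = ∀ t → massBelow N A t ≤ massBelow N B t

Dominated-resp : ∀ {N A A′ B B′} → (∀ y → A y ≡ A′ y) → (∀ y → B y ≡ B′ y) →
                 Dominated N A B → Dominated N A′ B′
Dominated-resp {N} A≗A′ B≗B′ A≼B t = subst₂ _≤_
  (sum-cong-≗ {N} (λ y → cong (_⊓ t) (A≗A′ (toℕ y))))
  (sum-cong-≗ {N} (λ y → cong (_⊓ t) (B≗B′ (toℕ y))))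
  (A≼B t)

massBelow-suc : ∀ N f s → massBelow N f (suc s) ≡ massBelow N f s + countAtLeast N f (suc s)
massBelow-suc N f s = trans (sum-cong-≗ {N} (λ y → ⊓-suc (f (toℕ y)) s)) (∑-distrib-+ {N} _ _)

massBelow-bump : ∀ {N i} f t → i < N →
                 massBelow N (bump i f) t ≡ 𝟙 (f i <? t) + massBelow N f t
massBelow-bump {N} {i} f t i<N = begin
  massBelow N (bump i f) t
    ≡⟨ sum-cong-≗ {N} (pointwise ∘ toℕ) ⟩
  sumBelow N (λ y → δ i y * 𝟙 (f y <? t) + f y ⊓ t)
    ≡⟨ ∑-distrib-+ {N} _ _ ⟩
  sumBelow N (λ y → δ i y * 𝟙 (f y <? t)) + massBelow N f t
    ≡⟨ cong (_+ massBelow N f t) (sumBelow-δ* (λ y → 𝟙 (f y <? t)) i<N) ⟩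
  𝟙 (f i <? t) + massBelow N f t
    ∎
  where
  open ≡-Reasoning
  pointwise : ∀ y → bump i f y ⊓ t ≡ δ i y * 𝟙 (f y <? t) + f y ⊓ t
  pointwise y with i ≟ y
  ... | yes refl rewrite δ-≡ {i} refl =
    trans (⊓-+1 (f i) t) (cong (_+ f i ⊓ t) (sym (*-identityˡ _)))
  ... | no i≢y   rewrite δ-≢ i≢y =
    cong (_⊓ t) (+-identityʳ (f y))

massBelow+countAtLeast : ∀ N f t k →
  massBelow N f t + k * countAtLeast N f t ≡ sumBelow N (λ y → f y ⊓ t + k * 𝟙 (t ≤? f y))
massBelow+countAtLeast N f t k =
  trans (cong (massBelow N f t +_) (*-distribˡ-sum {N} k _)) (sym (∑-distrib-+ {N} _ _))

massBelow-flat : ∀ {N f t k} → (∀ y → f y < t ⊎ t + k ≤ f y) →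
                 massBelow N f (t + k) ≡ massBelow N f t + k * countAtLeast N f t
massBelow-flat {N} {f} {t} {k} flat =
  trans (sum-cong-≗ {N} (λ y → ⊓-+-outside (flat (toℕ y))))
        (sym (massBelow+countAtLeast N f t k))

massBelow-straddle : ∀ {N f t k x} → x < N → t ≤ f x → f x < t + k →
                     massBelow N f (t + k) < massBelow N f t + k * countAtLeast N f t
massBelow-straddle {N} {f} {t} {k} x<N t≤fx fx<t+k = subst (massBelow N f (t + k) <_)
  (sym (massBelow+countAtLeast N f t k))
  (sumBelow-mono-< (λ y → ⊓-+-≤ (f y) t k) x<N (⊓-+-inside t≤fx fx<t+k))

-- If Φ_B(t) ≤ Φ_A(t), comparing with level t - 1 shows that fewer B-loads than A-loads reach t.
-- Up to level e = t + k, Φ_A then gains k for each A-load reaching t, as no A-load lies in [t, e),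
-- while Φ_B gains strictly less because of B x ∈ [t, e); so Φ_A(e) > Φ_B(e).
dominated-strict : ∀ {N A B a t e x} → Dominated N A B → (∀ y → A y ≤ a ⊎ e ≤ A y) →
                   a < t → x < N → t ≤ B x → B x < e →
                   massBelow N A t < massBelow N B t
dominated-strict {N} {A} {B} {a} {suc s} {e} {x} A≼B gap (s≤s a≤s) x<N t≤Bx Bx<e
  with k , refl ← m≤n⇒∃[o]m+o≡n (<⇒≤ (≤-<-trans t≤Bx Bx<e))
  = ≰⇒> B≰A
  where
  t = suc s
  flat : ∀ y → A y < t ⊎ t + k ≤ A y
  flat y with gap y
  ... | inj₁ Ay≤a = inj₁ (s≤s (≤-trans Ay≤a a≤s))
  ... | inj₂ e≤Ay = inj₂ e≤Ay
  B≰A : massBelow N B t ≰ massBelow N A t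
  B≰A B≤A = <-irrefl refl (begin-strict
    massBelow N A t + k * countAtLeast N A t ≡⟨ massBelow-flat {N} flat ⟨
    massBelow N A (t + k)                    ≤⟨ A≼B (t + k) ⟩
    massBelow N B (t + k)                    <⟨ massBelow-straddle x<N t≤Bx Bx<e ⟩
    massBelow N B t + k * countAtLeast N B t ≤⟨ +-mono-≤ B≤A (*-monoʳ-≤ k countB≤countA) ⟩
    massBelow N A t + k * countAtLeast N A t ∎)
    where
    open ≤-Reasoning
    countB≤countA : countAtLeast N B t ≤ countAtLeast N A t
    countB≤countA = +-cancelˡ-≤ (massBelow N A s) _ _ (begin
      massBelow N A s + countAtLeast N B t ≤⟨ +-monoˡ-≤ _ (A≼B s) ⟩
      massBelow N B s + countAtLeast N B t ≡⟨ massBelow-suc N B s ⟨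
      massBelow N B t                      ≤⟨ B≤A ⟩
      massBelow N A t                      ≡⟨ massBelow-suc N A s ⟩
      massBelow N A s + countAtLeast N A t ∎)

dominated-bump : ∀ {N A B i x e} → Dominated N A B → (∀ y → A y ≤ A i ⊎ e ≤ A y) →
                 i < N → x < N → B x < e → Dominated N (bump i A) (bump x B)
dominated-bump {N} {A} {B} {i} {x} A≼B gap i<N x<N Bx<e t
  rewrite massBelow-bump A t i<N | massBelow-bump B t x<N with A i <? t | B x <? t
... | no _     | _        = ≤-trans (A≼B t) (m≤n+m _ _)
... | yes _    | yes _    = s≤s (A≼B t)
... | yes Ai<t | no Bx≮t  = dominated-strict A≼B gap Ai<t x<N (≮⇒≥ Bx≮t) Bx<e

-- Feasibility of unit-time schedules

-- A unit-time schedule is the list of machine labels of its jobs in job order; V is the load vector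
-- before its first job.
data FeasibleFrom : (ℕ → ℕ) → List ℕ → List ℕ → Set where
  []  : ∀ {V} → FeasibleFrom V [] []
  _∷_ : ∀ {V x e xs es} → V x + 1 ≤ e → FeasibleFrom (bump x V) xs es →
        FeasibleFrom V (x ∷ xs) (e ∷ es)

FeasibleFrom-resp : ∀ {V V′ xs es} → (∀ y → V y ≡ V′ y) →
                    FeasibleFrom V xs es → FeasibleFrom V′ xs es
FeasibleFrom-resp V≗V′ []                          = []
FeasibleFrom-resp V≗V′ (_∷_ {x = x} fits feasible) =
  subst (λ v → v + 1 ≤ _) (V≗V′ x) fits
  ∷ FeasibleFrom-resp (λ y → cong (_+ δ x y) (V≗V′ y)) feasible

filter-map : ∀ {A B : Set} {P : B → Set} (P? : Decidable P) (f : A → B) xs →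
             filter P? (map f xs) ≡ map f (filter (P? ∘ f) xs)
filter-map P? f []       = refl
filter-map P? f (x ∷ xs) with does (P? (f x))
... | true  = cong (f x ∷_) (filter-map P? f xs)
... | false = filter-map P? f xs

module _ {n} (p σ : Fin (suc n) → ℕ) where

  private
    OnSameMachineBefore : Fin (suc n) → Fin (suc n) → Set
    OnSameMachineBefore j k = toℕ k ≤ toℕ j × σ k ≡ σ j

    onSameMachineBefore? : ∀ j → Decidable (OnSameMachineBefore j)
    onSameMachineBefore? j k = (toℕ k ≤? toℕ j) ×-dec (σ k ≟ σ j)

  loadUpTo-zero : loadUpTo (suc n) p σ fzero ≡ p fzero
  loadUpTo-zero = begin
    sum (map p (filter (onSameMachineBefore? fzero) (fzero ∷ tabulate fsuc)))
      ≡⟨ cong (sum ∘ map p) (filter-accept (onSameMachineBefore? fzero) (z≤n , refl)) ⟩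
    p fzero + sum (map p (filter (onSameMachineBefore? fzero) (tabulate fsuc)))
      ≡⟨ cong (λ ks → p fzero + sum (map p ks))
              (filter-none (onSameMachineBefore? fzero) (tabulate⁺ {f = fsuc} λ { _ (() , _) })) ⟩
    p fzero + 0
      ≡⟨ +-identityʳ (p fzero) ⟩
    p fzero ∎
    where open ≡-Reasoning

  private
    load-after-first : ∀ j → sum (map p (filter (onSameMachineBefore? (fsuc j)) (tabulate fsuc)))
                             ≡ loadUpTo n (p ∘ fsuc) (σ ∘ fsuc) j
    load-after-first j = begin
      sum (map p (filter (onSameMachineBefore? (fsuc j)) (tabulate fsuc)))
        ≡⟨ cong (sum ∘ map p ∘ filter (onSameMachineBefore? (fsuc j))) (map-tabulate id fsuc) ⟨
      sum (map p (filter (onSameMachineBefore? (fsuc j)) (map fsuc (allFin n))))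
        ≡⟨ cong (sum ∘ map p) (filter-map (onSameMachineBefore? (fsuc j)) fsuc (allFin n)) ⟩
      sum (map p (map fsuc (filter (onSameMachineBefore? (fsuc j) ∘ fsuc) (allFin n))))
        ≡⟨ cong sum (map-∘ (filter (onSameMachineBefore? (fsuc j) ∘ fsuc) (allFin n))) ⟨
      sum (map (p ∘ fsuc) (filter (onSameMachineBefore? (fsuc j) ∘ fsuc) (allFin n)))
        ≡⟨ cong (sum ∘ map (p ∘ fsuc)) (filter-≐ (onSameMachineBefore? (fsuc j) ∘ fsuc) _
             ((λ (le , eq) → s≤s⁻¹ le , eq) , (λ (le , eq) → s≤s le , eq)) (allFin n)) ⟩
      loadUpTo n (p ∘ fsuc) (σ ∘ fsuc) j ∎
      where open ≡-Reasoning

  loadUpTo-suc : ∀ j → loadUpTo (suc n) p σ (fsuc j)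
                       ≡ δ (σ fzero) (σ (fsuc j)) * p fzero + loadUpTo n (p ∘ fsuc) (σ ∘ fsuc) j
  loadUpTo-suc j with σ fzero ≟ σ (fsuc j)
  ... | yes same
    rewrite filter-accept (onSameMachineBefore? (fsuc j)) {xs = tabulate fsuc} (z≤n , same) | δ-≡ same =
        cong₂ _+_ (sym (+-identityʳ (p fzero))) (load-after-first j)
  ... | no differ
    rewrite filter-reject (onSameMachineBefore? (fsuc j)) {xs = tabulate fsuc} (differ ∘ proj₂) | δ-≢ differ =
        load-after-first j

FeasibleAfter : (ℕ → ℕ) → (n : ℕ) → (p d σ : Fin n → ℕ) → Set
FeasibleAfter V n p d σ = ∀ j → V (σ j) + loadUpTo n p σ j ≤ d j

module _ {n} (V : ℕ → ℕ) (p σ : Fin (suc n) → ℕ) (p₀≡1 : p fzero ≡ 1) where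

  loadUpTo-first-unit : V (σ fzero) + loadUpTo (suc n) p σ fzero ≡ V (σ fzero) + 1
  loadUpTo-first-unit = cong (V (σ fzero) +_) (trans (loadUpTo-zero p σ) p₀≡1)

  loadUpTo-later-unit : ∀ j → V (σ (fsuc j)) + loadUpTo (suc n) p σ (fsuc j)
                    ≡ bump (σ fzero) V (σ (fsuc j)) + loadUpTo n (p ∘ fsuc) (σ ∘ fsuc) j
  loadUpTo-later-unit j = begin
    V y + loadUpTo (suc n) p σ (fsuc j) ≡⟨ cong (V y +_) (loadUpTo-suc p σ j) ⟩
    V y + (δ x y * p fzero + rest)      ≡⟨ cong (λ q → V y + (δ x y * q + rest)) p₀≡1 ⟩
    V y + (δ x y * 1 + rest)            ≡⟨ cong (λ q → V y + (q + rest)) (*-identityʳ (δ x y)) ⟩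
    V y + (δ x y + rest)                ≡⟨ +-assoc (V y) (δ x y) rest ⟨
    V y + δ x y + rest                  ∎
    where
    open ≡-Reasoning
    x = σ fzero
    y = σ (fsuc j)
    rest = loadUpTo n (p ∘ fsuc) (σ ∘ fsuc) j

feasibleAfter⇒feasibleFrom : ∀ {V} n (p d σ : Fin n → ℕ) → (∀ j → p j ≡ 1) →
                             FeasibleAfter V n p d σ → FeasibleFrom V (tabulate σ) (tabulate d)
feasibleAfter⇒feasibleFrom zero    p d σ _   _        = []
feasibleAfter⇒feasibleFrom {V} (suc n) p d σ p≡1 feasible =
  subst (_≤ d fzero) (loadUpTo-first-unit V p σ (p≡1 fzero)) (feasible fzero)
  ∷ feasibleAfter⇒feasibleFrom n (p ∘ fsuc) (d ∘ fsuc) (σ ∘ fsuc) (p≡1 ∘ fsuc)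
      (λ j → subst (_≤ d (fsuc j)) (loadUpTo-later-unit V p σ (p≡1 fzero) j) (feasible (fsuc j)))

feasibleFrom⇒feasibleAfter : ∀ {V} n (p d σ : Fin n → ℕ) → (∀ j → p j ≡ 1) →
                             FeasibleFrom V (tabulate σ) (tabulate d) → FeasibleAfter V n p d σ
feasibleFrom⇒feasibleAfter {V} (suc n) p d σ p≡1 (fits ∷ _) fzero =
  subst (_≤ d fzero) (sym (loadUpTo-first-unit V p σ (p≡1 fzero))) fits
feasibleFrom⇒feasibleAfter {V} (suc n) p d σ p≡1 (_ ∷ feasible) (fsuc j) =
  subst (_≤ d (fsuc j)) (sym (loadUpTo-later-unit V p σ (p≡1 fzero) j))
    (feasibleFrom⇒feasibleAfter n (p ∘ fsuc) (d ∘ fsuc) (σ ∘ fsuc) (p≡1 ∘ fsuc) feasible j)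

loads-filter-self : ∀ x zs → loads (filter (¬? ∘ (x ≟_)) zs) x ≡ 0
loads-filter-self x []       = refl
loads-filter-self x (z ∷ zs) with x ≟ z
... | yes refl rewrite filter-reject (¬? ∘ (x ≟_)) {xs = zs} (λ x≢x → x≢x refl) =
  loads-filter-self x zs
... | no x≢z   rewrite filter-accept (¬? ∘ (x ≟_)) {xs = zs} x≢z | δ-≢ (x≢z ∘ sym) =
  loads-filter-self x zs

loads-filter-other : ∀ {x y} zs → x ≢ y → loads (filter (¬? ∘ (x ≟_)) zs) y ≡ loads zs y
loads-filter-other             []       _   = refl
loads-filter-other {x} {y} (z ∷ zs) x≢y with x ≟ z
... | yes refl rewrite filter-reject (¬? ∘ (x ≟_)) {xs = zs} (λ x≢x → x≢x refl) | δ-≢ x≢y =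
  loads-filter-other zs x≢y
... | no x≢z   rewrite filter-accept (¬? ∘ (x ≟_)) {xs = zs} x≢z =
  cong (δ z y +_) (loads-filter-other zs x≢y)

loads-deduplicate : ∀ xs y → loads (deduplicate _≟_ xs) y ≡ loads xs y ⊓ 1
loads-deduplicate []       y = refl
loads-deduplicate (x ∷ xs) y with x ≟ y
... | yes refl rewrite δ-≡ {x} refl | loads-filter-self x (deduplicate _≟_ xs) =
  cong suc (sym (⊓-zeroʳ (loads xs x)))
... | no x≢y   rewrite δ-≢ x≢y      | loads-filter-other (deduplicate _≟_ xs) x≢y =
  loads-deduplicate xs y

length≡sumBelow-loads : ∀ {N xs} → All (_< N) xs → length xs ≡ sumBelow N (loads xs)
length≡sumBelow-loads {N} []                  = sym (sum-replicate-zero N)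
length≡sumBelow-loads {N} {x ∷ xs} (x<N ∷ xs<N) = sym (begin
  sumBelow N (loads (x ∷ xs))
    ≡⟨ ∑-distrib-+ {N} _ _ ⟩
  sumBelow N (δ x) + sumBelow N (loads xs)
    ≡⟨ cong₂ _+_ (sumBelow-δ x<N) (sym (length≡sumBelow-loads xs<N)) ⟩
  1 + length xs
    ∎)
  where open ≡-Reasoning

length-deduplicate≡massBelow : ∀ {N xs} → All (_< N) xs →
                               length (deduplicate _≟_ xs) ≡ massBelow N (loads xs) 1
length-deduplicate≡massBelow {N} {xs} xs<N =
  trans (length≡sumBelow-loads (deduplicate⁺ _≟_ xs<N))
        (sum-cong-≗ {N} (loads-deduplicate xs ∘ toℕ))

machinesUsed≡massBelow : ∀ {N} n (σ : Fin n → ℕ) → All (_< N) (tabulate σ) →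
                         machinesUsed n σ ≡ massBelow N (loads (tabulate σ)) 1
machinesUsed≡massBelow n σ σ<N =
  trans (cong (length ∘ deduplicate _≟_) (map-tabulate id σ)) (length-deduplicate≡massBelow σ<N)

-- First fit on unit jobs

Nonincreasing : (ℕ → ℕ) → Set
Nonincreasing f = ∀ y → f (suc y) ≤ f y

nonincreasing-antitone : ∀ {f i y} → Nonincreasing f → i ≤ y → f y ≤ f i
nonincreasing-antitone {f} f↓ i≤y = go (≤⇒≤′ i≤y)
  where
  go : ∀ {i y} → i ≤′ y → f y ≤ f i
  go ≤′-refl       = ≤-refl
  go (≤′-step i≤y) = ≤-trans (f↓ _) (go i≤y)

nonincreasing-gap : ∀ {f i e} → Nonincreasing f → (∀ y → y < i → e ≤ f y) →
                    ∀ y → f y ≤ f i ⊎ e ≤ f y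
nonincreasing-gap {i = i} f↓ full y with y <? i
... | yes y<i = inj₂ (full y y<i)
... | no y≮i  = inj₁ (nonincreasing-antitone f↓ (≮⇒≥ y≮i))

nonincreasing-bump : ∀ {f i e} → Nonincreasing f → f i + 1 ≤ e → (∀ y → y < i → e ≤ f y) →
                     Nonincreasing (bump i f)
nonincreasing-bump {f} {i} {e} f↓ fits full y with i ≟ suc y
... | yes refl rewrite δ-≡ {y} refl | δ-≢ {suc y} {y} 1+n≢n = begin
  f (suc y) + 1 ≤⟨ fits ⟩
  e             ≤⟨ full y ≤-refl ⟩
  f y           ≡⟨ +-identityʳ (f y) ⟨
  f y + 0       ∎
  where open ≤-Reasoning
... | no i≢1+y rewrite δ-≢ i≢1+y = begin
  f (suc y) + 0 ≡⟨ +-identityʳ (f (suc y)) ⟩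
  f (suc y)     ≤⟨ f↓ y ⟩
  f y           ≤⟨ m≤m+n (f y) (δ i y) ⟩
  f y + δ i y   ∎
  where open ≤-Reasoning

record Placed (e : ℕ) (W : List ℕ) (i : ℕ) (W′ : List ℕ) (s : ℕ) : Set where
  field
    fits        : nth W i + 1 ≤ e
    earlierFull : ∀ y → y < i → e ≤ nth W y
    updated     : ∀ y → nth W′ y ≡ bump i (nth W) y
    index≤      : i ≤ length W
    length≤     : length W′ ≤ suc (length W)
    cost≡       : s ≡ suc i

placement : ∀ e W → 1 ≤ e → let (i , W′ , s) = place 1 e W in Placed e W i W′ s
placement e []       1≤e = record
  { fits = 1≤e ; earlierFull = λ _ () ; updated = updated
  ; index≤ = z≤n ; length≤ = ≤-refl ; cost≡ = refl }
  where
  updated : ∀ y → nth (1 ∷ []) y ≡ bump 0 (nth []) y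
  updated zero    = refl
  updated (suc y) = refl
placement e (l ∷ ls) 1≤e with l + 1 ≤? e
... | yes l+1≤e = record
  { fits = l+1≤e ; earlierFull = λ _ () ; updated = updated
  ; index≤ = z≤n ; length≤ = n≤1+n _ ; cost≡ = refl }
  where
  updated : ∀ y → nth ((l + 1) ∷ ls) y ≡ bump 0 (nth (l ∷ ls)) y
  updated zero    = refl
  updated (suc y) = sym (+-identityʳ _)
... | no l+1≰e with place 1 e ls | placement e ls 1≤e
...   | i , ls′ , s | placed = record
  { fits = fits ; earlierFull = earlierFull ; updated = updated
  ; index≤ = s≤s index≤ ; length≤ = s≤s length≤ ; cost≡ = cong suc cost≡ }
  where
  open Placed placed using (fits; index≤; length≤; cost≡)
  earlierFull : ∀ y → y < suc i → e ≤ nth (l ∷ ls) y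
  earlierFull zero    _         = ≤-pred (subst (e <_) (+-comm l 1) (≰⇒> l+1≰e))
  earlierFull (suc y) (s≤s y<i) = Placed.earlierFull placed y y<i
  updated : ∀ y → nth (l ∷ ls′) y ≡ bump (suc i) (nth (l ∷ ls)) y
  updated zero    = sym (+-identityʳ l)
  updated (suc y) = Placed.updated placed y

placed-index< : ∀ {e W i W′ s} → Placed e W i W′ s → ∀ m → i < length W + suc m
placed-index< {W = W} placed m =
  ≤-trans (s≤s (Placed.index≤ placed))
          (≤-trans (m≤m+n _ m) (≤-reflexive (sym (+-suc (length W) m))))

placed-length≤ : ∀ {e W i W′ s} → Placed e W i W′ s → ∀ m →
                 length W′ + m ≤ length W + suc m
placed-length≤ {W = W} placed m =
  ≤-trans (+-monoˡ-≤ m (Placed.length≤ placed)) (≤-reflexive (sym (+-suc (length W) m)))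

unitJobs : List ℕ → List (ℕ × ℕ)
unitJobs = map (1 ,_)

ffAssignment : List ℕ → List ℕ → List ℕ
ffAssignment es W = proj₁ (ffGo (unitJobs es) W)

ffCost : List ℕ → List ℕ → ℕ
ffCost es W = proj₂ (ffGo (unitJobs es) W)

ffGo-unit-∷ : ∀ e es W →
  ffGo (unitJobs (e ∷ es)) W
    ≡ (let (i , W′ , s) = place 1 e W in i ∷ ffAssignment es W′ , s + ffCost es W′)
ffGo-unit-∷ e es W with place 1 e W
... | i , W′ , s with ffGo (unitJobs es) W′
...   | as , s′ = refl

length-ffAssignment : ∀ es W → length (ffAssignment es W) ≡ length es
length-ffAssignment []       W = refl
length-ffAssignment (e ∷ es) W rewrite ffGo-unit-∷ e es W = cong suc (length-ffAssignment es _)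

ff-feasible : ∀ es W → All (1 ≤_) es → FeasibleFrom (nth W) (ffAssignment es W) es
ff-feasible []       W []            = []
ff-feasible (e ∷ es) W (1≤e ∷ 1≤es) rewrite ffGo-unit-∷ e es W =
  fits ∷ FeasibleFrom-resp updated (ff-feasible es _ 1≤es)
  where open Placed (placement e W 1≤e)

ff-labels : ∀ es W → All (1 ≤_) es → All (_< length W + length es) (ffAssignment es W)
ff-labels []       W []            = []
ff-labels (e ∷ es) W (1≤e ∷ 1≤es) rewrite ffGo-unit-∷ e es W =
  placed-index< placed (length es)
    ∷ All.map (λ lt → ≤-trans lt (placed-length≤ placed (length es))) (ff-labels es _ 1≤es)
  where placed = placement e W 1≤e

ff-cost : ∀ es W → All (1 ≤_) es → ffCost es W ≤ length es * (length W + length es)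
ff-cost []       W []            = z≤n
ff-cost (e ∷ es) W (1≤e ∷ 1≤es) rewrite ffGo-unit-∷ e es W = begin
  s + ffCost es W′                  ≤⟨ +-mono-≤ s≤ (ff-cost es W′ 1≤es) ⟩
  (L + suc m) + m * (length W′ + m) ≤⟨ +-monoʳ-≤ (L + suc m) (*-monoʳ-≤ m (placed-length≤ placed m)) ⟩
  (L + suc m) + m * (L + suc m)     ∎
  where
  open ≤-Reasoning
  placed = placement e W 1≤e
  W′ = proj₁ (proj₂ (place 1 e W))
  s = proj₂ (proj₂ (place 1 e W))
  L = length W
  m = length es
  s≤ : s ≤ L + suc m
  s≤ = subst (_≤ L + suc m) (sym (Placed.cost≡ placed)) (placed-index< placed m)

ff-dominates : ∀ {N V xs} es W → Nonincreasing (nth W) → length W + length es ≤ N →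
               All (_< N) xs → FeasibleFrom V xs es → Dominated N (nth W) V →
               Dominated N (λ y → nth W y + loads (ffAssignment es W) y) (λ y → V y + loads xs y)
ff-dominates {N} {V} [] W _ _ [] [] W≼V =
  Dominated-resp {N} (λ y → sym (+-identityʳ (nth W y))) (λ y → sym (+-identityʳ (V y))) W≼V
ff-dominates {N} {V} (e ∷ es) W W↓ room (x<N ∷ xs<N)
             (_∷_ {x = x} {xs = xs} Vx+1≤e feasible) W≼V
  rewrite ffGo-unit-∷ e es W =
  Dominated-resp {N} ff-reassoc (λ y → +-assoc (V y) (δ x y) (loads xs y))
    (ff-dominates es W′ W′↓ room′ xs<N feasible W′≼)
  where
  placed = placement e W (m+n≤o⇒n≤o (V x) Vx+1≤e)
  open Placed placed
  i = proj₁ (place 1 e W)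
  W′ = proj₁ (proj₂ (place 1 e W))
  W′↓ : Nonincreasing (nth W′)
  W′↓ y = subst₂ _≤_ (sym (updated (suc y))) (sym (updated y))
                (nonincreasing-bump W↓ fits earlierFull y)
  room′ : length W′ + length es ≤ N
  room′ = ≤-trans (placed-length≤ placed _) room
  W′≼ : Dominated N (nth W′) (bump x V)
  W′≼ = Dominated-resp {N} (sym ∘ updated) (λ y → refl {x = bump x V y})
    (dominated-bump W≼V (nonincreasing-gap W↓ earlierFull) (≤-trans (placed-index< placed _) room)
                    x<N (subst (_≤ e) (+-comm (V x) 1) Vx+1≤e))
  as′ = ffAssignment es W′
  ff-reassoc : ∀ y → nth W′ y + loads as′ y ≡ nth W y + (δ i y + loads as′ y)
  ff-reassoc y = trans (cong (_+ loads as′ y) (updated y)) (+-assoc (nth W y) (δ i y) (loads as′ y))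

unitJobs-tabulate : ∀ n (p d : Fin n → ℕ) → (∀ j → p j ≡ 1) →
                    map (λ j → p j , d j) (allFin n) ≡ unitJobs (tabulate d)
unitJobs-tabulate n p d p≡1 =
  trans (map-tabulate id _)
        (trans (tabulate-cong (λ j → cong (_, d j) (p≡1 j))) (sym (map-tabulate d (1 ,_))))

tabulate-nth : ∀ n xs → length xs ≡ n → tabulate (λ (j : Fin n) → nth xs (toℕ j)) ≡ xs
tabulate-nth zero    []       _   = refl
tabulate-nth (suc n) (x ∷ xs) len = cong (x ∷_) (tabulate-nth n xs (suc-injective len))

module UnitInstance {n} (p d : Fin n → ℕ) (p≡1 : ∀ j → p j ≡ 1) (p≤d : ∀ j → p j ≤ d j)
  where

  deadlines : List ℕ
  deadlines = tabulate d

  assignment : List ℕ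
  assignment = ffAssignment deadlines []

  1≤deadlines : All (1 ≤_) deadlines
  1≤deadlines = tabulate⁺ (λ j → subst (_≤ d j) (p≡1 j) (p≤d j))

  ffRun-unit : ffRun n p d ≡ ffGo (unitJobs deadlines) []
  ffRun-unit = cong (λ jobs → ffGo jobs []) (unitJobs-tabulate n p d p≡1)

  tabulate-ffSchedule : tabulate (ffSchedule n p d) ≡ assignment
  tabulate-ffSchedule = begin
    tabulate (ffSchedule n p d)
      ≡⟨ cong (λ run → tabulate (λ j → nth (proj₁ run) (toℕ j))) ffRun-unit ⟩
    tabulate (λ j → nth assignment (toℕ j))
      ≡⟨ tabulate-nth n assignment (trans (length-ffAssignment deadlines []) (length-tabulate d)) ⟩
    assignment
      ∎
    where open ≡-Reasoning

ffSchedule-feasible : ∀ n (p d : Fin n → ℕ) → (∀ j → p j ≡ 1) → (∀ j → p j ≤ d j) →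
                      Feasible n p d (ffSchedule n p d)
ffSchedule-feasible n p d p≡1 p≤d = feasibleFrom⇒feasibleAfter n p d (ffSchedule n p d) p≡1
  (subst (λ as → FeasibleFrom (λ _ → 0) as deadlines) (sym tabulate-ffSchedule)
         (ff-feasible deadlines [] 1≤deadlines))
  where open UnitInstance p d p≡1 p≤d

ffSchedule-optimal : ∀ n (p d : Fin n → ℕ) → (∀ j → p j ≡ 1) → (∀ j → p j ≤ d j) →
                     ∀ σ → Feasible n p d σ →
                     machinesUsed n (ffSchedule n p d) ≤ machinesUsed n σ
ffSchedule-optimal n p d p≡1 p≤d σ σ-feasible = begin
  machinesUsed n (ffSchedule n p d)
    ≡⟨ machinesUsed≡massBelow n (ffSchedule n p d) (subst (All (_< N)) (sym tabulate-ffSchedule) ff<N) ⟩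
  massBelow N (loads (tabulate (ffSchedule n p d))) 1
    ≡⟨ cong (λ as → massBelow N (loads as) 1) tabulate-ffSchedule ⟩
  massBelow N (loads assignment) 1
    ≤⟨ ff-dominates deadlines [] (λ _ → z≤n) room σ<N
                    (feasibleAfter⇒feasibleFrom n p d σ p≡1 σ-feasible) (λ _ → ≤-refl) 1 ⟩
  massBelow N (loads (tabulate σ)) 1
    ≡⟨ machinesUsed≡massBelow n σ σ<N ⟨
  machinesUsed n σ
    ∎
  where
  open UnitInstance p d p≡1 p≤d
  open ≤-Reasoning
  N = n + suc (max 0 (tabulate σ))
  room : length deadlines ≤ N
  room = ≤-trans (≤-reflexive (length-tabulate d)) (m≤m+n n _)
  σ<N : All (_< N) (tabulate σ)
  σ<N = All.map (λ x≤max → ≤-trans (s≤s x≤max) (m≤n+m _ n)) (xs≤max 0 (tabulate σ))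
  ff<N : All (_< N) assignment
  ff<N = All.map (λ x<n → ≤-trans x<n room) (ff-labels deadlines [] 1≤deadlines)

ffSteps-quadratic : ∀ n (p d : Fin n → ℕ) → (∀ j → p j ≡ 1) → (∀ j → p j ≤ d j) →
                    ffSteps n p d ≤ n * n
ffSteps-quadratic n p d p≡1 p≤d = begin
  ffSteps n p d                        ≡⟨ cong proj₂ ffRun-unit ⟩
  ffCost deadlines []                  ≤⟨ ff-cost deadlines [] 1≤deadlines ⟩
  length deadlines * length deadlines  ≡⟨ cong (λ m → m * m) (length-tabulate d) ⟩
  n * n                                ∎
  where
  open UnitInstance p d p≡1 p≤d
  open ≤-Reasoning

theorem1 : ((n : ℕ) (p d : Fin n → ℕ) → (∀ j → p j ≡ 1) → (∀ j → p j ≤ d j)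
               → Feasible n p d (ffSchedule n p d)
                 × (∀ (σ : Fin n → ℕ) → Feasible n p d σ
                      → machinesUsed n (ffSchedule n p d) ≤ machinesUsed n σ))
             × ∃ (λ (c : ℕ) → (n : ℕ) (p d : Fin n → ℕ) → (∀ j → p j ≡ 1)
                  → (∀ j → p j ≤ d j) → ffSteps n p d ≤ c * (n * n))
theorem1 =
  (λ n p d p≡1 p≤d → ffSchedule-feasible n p d p≡1 p≤d , ffSchedule-optimal n p d p≡1 p≤d)
  , (1 , λ n p d p≡1 p≤d →
           subst (ffSteps n p d ≤_) (sym (*-identityˡ (n * n))) (ffSteps-quadratic n p d p≡1 p≤d))
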